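{- Let $T$ be a BFS-spanning tree of a connected graph $G$. Then for any diametral pair $(u,v)$ of $T$ and any $1$-join of $G$ with connecting sets $A_1,A_2$, at most one of $u,v$ lies in $A_1\cup A_2$.
   Context: A BFS-spanning tree of $G$ is a spanning tree obtained from a breadth-first search of $G$ (from some root). A pair of vertices $(u,v)$ of a tree $T$ is diametral if the length of the $u$–$v$ path in $T$ is maximum over all pairs of vertices of $T$. A $1$-join of $G$ is a partition $(V_1,V_2)$ of $V(G)$ together with sets $A_1\subseteq V_1$, $A_2\subseteq V_2$ such that $A_1\cup A_2$ is a clique, $V_1\setminus A_1$ has no neighbor in $V_2$, $V_2\setminus A_2$ has no neighbor in $V_1$, and $A_i\neq\emptyset$, $V_i\setminus A_i\neq\emptyset$ for $i=1,2$. -}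

module Defs where

open import Data.Nat using (ℕ; _≤_)
open import Data.Fin using (Fin)
open import Data.Bool using (Bool; true; false; T; not)
open import Data.List using (List; []; _∷_; _++_; [_]; length)
open import Data.List.Membership.Propositional using (_∈_; _∉_)
open import Data.List.Relation.Unary.Unique.Propositional using (Unique)
open import Data.Product using (Σ; ∃; ∃-syntax; _×_; _,_)
open import Data.Sum using (_⊎_)
open import Relation.Binary.PropositionalEquality using (_≡_; _≢_)
open import Relation.Binary.Construct.Closure.ReflexiveTransitive using (Star)

record Graph (n : ℕ) : Set where
  field
    adj    : Fin n → Fin n → Bool
    sym    : ∀ x y → adj x y ≡ adj y x
    irrefl : ∀ x → adj x x ≡ false
open Graph public

data Walk {n : ℕ} (R : Fin n → Fin n → Set) : Fin n → Fin n → List (Fin n) → Set where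
  here : ∀ {u} → Walk R u u (u ∷ [])
  step : ∀ {u w v vs} → R u w → Walk R w v vs → Walk R u v (u ∷ vs)

-- A path: a walk with pairwise distinct vertices.  Its length (number of
-- edges) is (length vs ∸ 1).
Path : {n : ℕ} → (Fin n → Fin n → Set) → Fin n → Fin n → List (Fin n) → Set
Path R u v vs = Walk R u v vs × Unique vs

GAdj : {n : ℕ} → Graph n → Fin n → Fin n → Set
GAdj G x y = T (adj G x y)

Connected : {n : ℕ} → Graph n → Set
Connected G = ∀ u v → ∃[ vs ] Path (GAdj G) u v vs

-- Breadth-first search, as a nondeterministic transition system.
-- State: queue, visited vertices, tree edges found so far (parent , child).

record BFSState (n : ℕ) : Set where
  constructor ⟨_,_,_⟩
  field
    queue   : List (Fin n)
    visited : List (Fin n)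
    edges   : List (Fin n × Fin n)

data BFSStep {n : ℕ} (G : Graph n) : BFSState n → BFSState n → Set where
  discover : ∀ x q vis es y → T (adj G x y) → y ∉ vis →
             BFSStep G ⟨ x ∷ q , vis , es ⟩ ⟨ x ∷ (q ++ [ y ]) , y ∷ vis , (x , y) ∷ es ⟩
  finish   : ∀ x q vis es → (∀ y → T (adj G x y) → y ∈ vis) →
             BFSStep G ⟨ x ∷ q , vis , es ⟩ ⟨ q , vis , es ⟩

IsBFSTree : {n : ℕ} → Graph n → List (Fin n × Fin n) → Set
IsBFSTree G es =
  ∃[ r ] ∃[ vis ] Star (BFSStep G) ⟨ r ∷ [] , r ∷ [] , [] ⟩ ⟨ [] , vis , es ⟩

TreeAdj : {n : ℕ} → List (Fin n × Fin n) → Fin n → Fin n → Set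
TreeAdj es x y = ((x , y) ∈ es) ⊎ ((y , x) ∈ es)

Diametral : {n : ℕ} → List (Fin n × Fin n) → Fin n → Fin n → Set
Diametral es u v =
  ∃[ vs ] (Path (TreeAdj es) u v vs ×
           (∀ x y ws → Path (TreeAdj es) x y ws → length ws ≤ length vs))

-- 1-joins.  V₁ is given by its characteristic function; V₂ is its complement.

In : {n : ℕ} → (Fin n → Bool) → Fin n → Set
In S x = T (S x)

Out : {n : ℕ} → (Fin n → Bool) → Fin n → Set
Out S x = T (not (S x))

NonAdj : {n : ℕ} → Graph n → Fin n → Fin n → Set
NonAdj G x y = adj G x y ≡ false

record OneJoin {n : ℕ} (G : Graph n) : Set where
  field
    V₁ A₁ A₂ : Fin n → Bool
    A₁⊆V₁    : ∀ x → In A₁ x → In V₁ x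
    A₂⊆V₂    : ∀ x → In A₂ x → Out V₁ x
    clique   : ∀ x y → (In A₁ x ⊎ In A₂ x) → (In A₁ y ⊎ In A₂ y) → x ≢ y → GAdj G x y
    sep₁     : ∀ x y → In V₁ x → Out A₁ x → Out V₁ y → NonAdj G x y
    sep₂     : ∀ x y → Out V₁ x → Out A₂ x → In V₁ y → NonAdj G x y
    A₁≠∅     : ∃[ x ] In A₁ x
    V₁∖A₁≠∅  : ∃[ x ] (In V₁ x × Out A₁ x)
    A₂≠∅     : ∃[ x ] In A₂ x
    V₂∖A₂≠∅  : ∃[ x ] (Out V₁ x × Out A₂ x)

-- BFS assigns every vertex its distance from the root as its depth, so the depths of
-- adjacent vertices differ by at most one.  In a 1-join the edges between V₁ and V₂ all
-- join A₁ to A₂, hence the tree path from the root into the other side crosses from p ∈ A₁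
-- to its child c ∈ A₂ (or vice versa).  Every vertex of the clique A₁ ∪ A₂ is p or a
-- neighbour of p, so has depth ≤ depth p + 1, whereas a vertex w of the other side outside
-- the A's is a proper descendant of c, of depth ≥ depth p + 2.  Finally, in a rooted tree a
-- diametral pair cannot have both ends strictly shallower than some vertex w: either the
-- path from u or from v to w is longer than the u–v path, or w descends from two different
-- children of the apex of the u–v path.
module Submission where

open import Defs hiding (sym)
open import Data.Nat using (ℕ; zero; suc; _+_; _∸_; _≤_; _<_; _≤?_; z≤n; s≤s)
open import Data.Nat.Properties hiding (_≟_)
open import Data.Nat.Tactic.RingSolver using (solve-∀)
open import Data.Fin using (Fin)
open import Data.Fin.Properties using (_≟_)
open import Data.Bool using (Bool; true; false; T; not)
open import Data.List using (List; []; _∷_; _++_; [_]; length)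
open import Data.List.Properties using (length-++)
open import Data.List.Membership.Propositional using (_∈_; _∉_)
open import Data.List.Membership.Propositional.Properties using (∈-++⁻; ∈-++⁺ˡ; ∈-++⁺ʳ)
open import Data.List.Relation.Unary.Any using (here; there)
open import Data.List.Relation.Unary.All as All using (All; []; _∷_)
open import Data.List.Relation.Unary.All.Properties using (All¬⇒¬Any; ¬Any⇒All¬)
open import Data.List.Relation.Unary.AllPairs as AllPairs using (AllPairs; []; _∷_)
import Data.List.Relation.Unary.AllPairs.Properties as AllPairsₚ
open import Data.List.Relation.Unary.Unique.Propositional using (Unique)
import Data.List.Relation.Unary.Unique.Propositional.Properties as Uniqueₚ
open import Data.Product using (∃-syntax; _×_; _,_; proj₁; proj₂)
import Data.Product as Product
open import Data.Sum using (_⊎_; inj₁; inj₂)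
import Data.Sum as Sum
open import Data.Unit using (⊤; tt)
open import Data.Empty using (⊥; ⊥-elim)
open import Data.Vec.Functional using (updateAt)
open import Data.Vec.Functional.Properties using (updateAt-updates; updateAt-minimal)
open import Function using (_∘_; const; id)
open import Relation.Nullary using (¬_; Dec; yes; no)
open import Relation.Nullary.Decidable using (T?)
open import Relation.Unary using (Decidable)
open import Relation.Binary.PropositionalEquality hiding ([_])
open import Relation.Binary.Construct.Closure.ReflexiveTransitive using (Star; ε; _◅_)

walk-∷ʳ : ∀ {n} {R : Fin n → Fin n → Set} {u v w vs} →
          Walk R u v vs → R v w → Walk R u w (vs ++ [ w ])
walk-∷ʳ here          r = step r here
walk-∷ʳ (step r′ rs) r = step r′ (walk-∷ʳ rs r)

suc-suc-+-double : ∀ m a → suc (suc m + (a + a)) ≡ m + (suc a + suc a)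
suc-suc-+-double = solve-∀

record RootedTree {n : ℕ} (es : List (Fin n × Fin n)) : Set where
  field
    root          : Fin n
    depth         : Fin n → ℕ
    depth-root    : depth root ≡ 0
    depth-child   : ∀ {p x} → (p , x) ∈ es → depth x ≡ suc (depth p)
    parent-unique : ∀ {p q x} → (p , x) ∈ es → (q , x) ∈ es → p ≡ q
    parent-exists : ∀ x → x ≢ root → ∃[ p ] ((p , x) ∈ es)

module RootedTreeProperties {n : ℕ} {es : List (Fin n × Fin n)} (T : RootedTree es) where

  open RootedTree T

  infix 4 _≼_
  data _≼_ : Fin n → Fin n → Set where
    ≼-refl  : ∀ {x} → x ≼ x
    ≼-child : ∀ {a p x} → a ≼ p → (p , x) ∈ es → a ≼ x

  ≼-trans : ∀ {a b x} → a ≼ b → b ≼ x → a ≼ x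
  ≼-trans a≼b ≼-refl          = a≼b
  ≼-trans a≼b (≼-child b≼p e) = ≼-child (≼-trans a≼b b≼p) e

  ≼⇒depth≤ : ∀ {a x} → a ≼ x → depth a ≤ depth x
  ≼⇒depth≤ ≼-refl = ≤-refl
  ≼⇒depth≤ (≼-child a≼p e) rewrite depth-child e = m≤n⇒m≤1+n (≼⇒depth≤ a≼p)

  ≼-child⇒depth< : ∀ {a p x} → a ≼ p → (p , x) ∈ es → depth a < depth x
  ≼-child⇒depth< a≼p e rewrite depth-child e = s≤s (≼⇒depth≤ a≼p)

  child⋠parent : ∀ {p x} → (p , x) ∈ es → ¬ x ≼ p
  child⋠parent e x≼p = <-irrefl refl (≼-child⇒depth< x≼p e)

  ≼∧depth≡⇒≡ : ∀ {a x} → a ≼ x → depth a ≡ depth x → a ≡ x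
  ≼∧depth≡⇒≡ ≼-refl          _  = refl
  ≼∧depth≡⇒≡ (≼-child a≼p e) eq = ⊥-elim (<-irrefl eq (≼-child⇒depth< a≼p e))

  ≼∧≢⇒depth< : ∀ {a x} → a ≼ x → a ≢ x → depth a < depth x
  ≼∧≢⇒depth< a≼x a≢x = ≤∧≢⇒< (≼⇒depth≤ a≼x) (a≢x ∘ ≼∧depth≡⇒≡ a≼x)

  ≼-antisym : ∀ {a b} → a ≼ b → b ≼ a → a ≡ b
  ≼-antisym a≼b b≼a = ≼∧depth≡⇒≡ a≼b (≤-antisym (≼⇒depth≤ a≼b) (≼⇒depth≤ b≼a))

  ≼-linear : ∀ {a b x} → a ≼ x → b ≼ x → depth a ≤ depth b → a ≼ b
  ≼-linear ≼-refl          ≼-refl            _     = ≼-refl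
  ≼-linear ≼-refl          (≼-child b≼p e)   da≤db = ⊥-elim (<⇒≱ (≼-child⇒depth< b≼p e) da≤db)
  ≼-linear (≼-child a≼p e) ≼-refl            _     = ≼-child a≼p e
  ≼-linear (≼-child a≼p e) (≼-child b≼p′ e′) da≤db with parent-unique e e′
  ... | refl = ≼-linear a≼p b≼p′ da≤db

  ≼-depth-injective : ∀ {a b x} → a ≼ x → b ≼ x → depth a ≡ depth b → a ≡ b
  ≼-depth-injective a≼x b≼x eq = ≼∧depth≡⇒≡ (≼-linear a≼x b≼x (≤-reflexive eq)) eq

  ≼-parent : ∀ {a p x} → a ≼ x → a ≢ x → (p , x) ∈ es → a ≼ p
  ≼-parent ≼-refl            a≢x _ = ⊥-elim (a≢x refl)
  ≼-parent (≼-child a≼p′ e′) _   e with parent-unique e′ e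
  ... | refl = a≼p′

  child-toward : ∀ {a x} → a ≼ x → a ≢ x → ∃[ c ] ((a , c) ∈ es × c ≼ x)
  child-toward ≼-refl a≢x = ⊥-elim (a≢x refl)
  child-toward {a} (≼-child {p = p} {x = x} a≼p e) _ with a ≟ p
  ... | yes refl = x , e , ≼-refl
  ... | no a≢p with child-toward a≼p a≢p
  ...   | c , ac , c≼p = c , ac , ≼-child c≼p e

  child-toward-deeper : ∀ {m a x} → m ≼ x → a ≼ x → depth m < depth a →
                        ∃[ c ] ((m , c) ∈ es × c ≼ a)
  child-toward-deeper m≼x a≼x dm<da =
    child-toward (≼-linear m≼x a≼x (<⇒≤ dm<da)) (λ { refl → <-irrefl refl dm<da })

  exit-edge : ∀ {P : Fin n → Set} → Decidable P → ∀ {a x} → a ≼ x → P a → ¬ P x →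
              ∃[ p ] ∃[ c ] ((p , c) ∈ es × P p × ¬ P c × c ≼ x)
  exit-edge P? ≼-refl Pa ¬Px = ⊥-elim (¬Px Pa)
  exit-edge P? (≼-child {p = p} {x = x} a≼p e) Pa ¬Px with P? p
  ... | yes Pp = p , x , e , Pp , ¬Px , ≼-refl
  ... | no ¬Pp with exit-edge P? a≼p Pa ¬Pp
  ...   | p′ , c , e′ , Pp′ , ¬Pc , c≼p = p′ , c , e′ , Pp′ , ¬Pc , ≼-child c≼p e

  depth≡0⇒root : ∀ {x} → depth x ≡ 0 → x ≡ root
  depth≡0⇒root {x} dx≡0 with x ≟ root
  ... | yes x≡r = x≡r
  ... | no x≢r with parent-exists x x≢r
  ...   | p , e = ⊥-elim (1+n≢0 (trans (sym (depth-child e)) dx≡0))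

  ancestor-at : ∀ k m x → depth x ≡ m + k → ∃[ b ] (b ≼ x × depth b ≡ k)
  ancestor-at k zero    x dx≡k = x , ≼-refl , dx≡k
  ancestor-at k (suc m) x dx≡1+m+k
    with parent-exists x (λ { refl → 0≢1+n (trans (sym depth-root) dx≡1+m+k) })
  ... | p , e with ancestor-at k m p (suc-injective (trans (sym (depth-child e)) dx≡1+m+k))
  ...   | b , b≼p , db≡k = b , ≼-child b≼p e , db≡k

  ancestor-at-depth : ∀ {k x} → k ≤ depth x → ∃[ b ] (b ≼ x × depth b ≡ k)
  ancestor-at-depth {k} {x} k≤dx = ancestor-at k (depth x ∸ k) x (sym (m∸n+n≡m k≤dx))

  root-≼ : ∀ x → root ≼ x
  root-≼ x with ancestor-at-depth {0} {x} z≤n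
  ... | b , b≼x , db≡0 = subst (_≼ x) (depth≡0⇒root db≡0) b≼x

  _≼?_ : ∀ a x → Dec (a ≼ x)
  a ≼? x with depth a ≤? depth x
  ... | no da≰dx = no (da≰dx ∘ ≼⇒depth≤)
  ... | yes da≤dx with ancestor-at-depth da≤dx
  ...   | b , b≼x , db≡da with a ≟ b
  ...     | yes refl = yes b≼x
  ...     | no a≢b   = no (λ a≼x → a≢b (≼-depth-injective a≼x b≼x (sym db≡da)))

  NoCommonChild : Fin n → Fin n → Fin n → Set
  NoCommonChild a x y = ∀ {c} → (a , c) ∈ es → c ≼ x → c ≼ y → ⊥

  IsLCA : Fin n → Fin n → Fin n → Set
  IsLCA a x y = a ≼ x × a ≼ y × NoCommonChild a x y

  lca-below : ∀ m {a x y} → depth x ≡ m + depth a → a ≼ x → a ≼ y → ∃[ b ] IsLCA b x y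
  lca-below zero {a} dx≡da a≼x a≼y =
    a , a≼x , a≼y ,
    λ ac c≼x _ → child⋠parent ac (subst (_ ≼_) (sym (≼∧depth≡⇒≡ a≼x (sym dx≡da))) c≼x)
  lca-below (suc m) {a} {x} {y} dx≡1+m+da a≼x a≼y
    with child-toward a≼x (λ { refl → <-irrefl dx≡1+m+da (s≤s (m≤n+m (depth a) m)) })
  ... | c , ac , c≼x with c ≼? y
  ...   | yes c≼y = lca-below m dx≡m+dc c≼x c≼y
    where
    dx≡m+dc : depth x ≡ m + depth c
    dx≡m+dc = trans dx≡1+m+da (trans (sym (+-suc m (depth a))) (cong (m +_) (sym (depth-child ac))))
  ...   | no c⋠y = a , a≼x , a≼y , λ ac′ c′≼x c′≼y →
    c⋠y (subst (_≼ y) (≼-depth-injective c′≼x c≼x (trans (depth-child ac′) (sym (depth-child ac))))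
               c′≼y)

  lca : ∀ x y → ∃[ a ] IsLCA a x y
  lca x y = lca-below (depth x) dx≡dx+dr (root-≼ x) (root-≼ y)
    where
    dx≡dx+dr : depth x ≡ depth x + depth root
    dx≡dx+dr = sym (trans (cong (depth x +_) depth-root) (+-identityʳ (depth x)))

  TreePath : Fin n → Fin n → List (Fin n) → Set
  TreePath = Path (TreeAdj es)

  descent : ∀ {a y} → a ≼ y →
            ∃[ ws ] (TreePath a y ws × length ws + depth a ≡ suc (depth y) ×
                     (∀ {z} → z ∈ ws → z ≼ y))
  descent ≼-refl = _ , (here , [] ∷ []) , refl , λ { (here refl) → ≼-refl }
  descent {a} {y} (≼-child {p = p} a≼p e) with descent a≼p
  ... | ws , (walk , unique) , len , on-ws =
    ws ++ [ y ] , (walk-∷ʳ walk (inj₁ e) , Uniqueₚ.++⁺ unique ([] ∷ []) disjoint) , len′ , on-ws′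
    where
    disjoint : ∀ {z} → ¬ (z ∈ ws × z ∈ [ y ])
    disjoint (z∈ws , here refl) = child⋠parent e (on-ws z∈ws)
    open ≡-Reasoning
    len′ : length (ws ++ [ y ]) + depth a ≡ suc (depth y)
    len′ = begin
      length (ws ++ [ y ]) + depth a ≡⟨ cong (_+ depth a) (length-++ ws) ⟩
      length ws + 1 + depth a        ≡⟨ +-assoc (length ws) 1 (depth a) ⟩
      length ws + suc (depth a)      ≡⟨ +-suc (length ws) (depth a) ⟩
      suc (length ws + depth a)      ≡⟨ cong suc (trans len (sym (depth-child e))) ⟩
      suc (depth y)                  ∎
    on-ws′ : ∀ {z} → z ∈ ws ++ [ y ] → z ≼ y
    on-ws′ z∈ with ∈-++⁻ ws z∈
    ... | inj₁ z∈ws        = ≼-child (on-ws z∈ws) e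
    ... | inj₂ (here refl) = ≼-refl

  via-lca : ∀ {a x y} → a ≼ x → a ≼ y → NoCommonChild a x y →
            ∃[ ws ] (TreePath x y ws × length ws + (depth a + depth a) ≡ depth x + depth y + 1 ×
                     (∀ {z} → z ∈ ws → z ≼ x ⊎ z ≼ y))
  via-lca {a} {x} {y} ≼-refl a≼y _ with descent a≼y
  ... | ws , path , len , on-ws = ws , path , len′ , inj₂ ∘ on-ws
    where
    open ≡-Reasoning
    len′ : length ws + (depth a + depth a) ≡ depth a + depth y + 1
    len′ = begin
      length ws + (depth a + depth a) ≡⟨ sym (+-assoc (length ws) (depth a) (depth a)) ⟩
      length ws + depth a + depth a   ≡⟨ cong (_+ depth a) len ⟩
      suc (depth y + depth a)         ≡⟨ cong suc (+-comm (depth y) (depth a)) ⟩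
      suc (depth a + depth y)         ≡⟨ +-comm 1 (depth a + depth y) ⟩
      depth a + depth y + 1           ∎
  via-lca {a} {x} {y} (≼-child {p = p} a≼p e) a≼y no-common
    with via-lca a≼p a≼y (λ ac c≼p c≼y → no-common ac (≼-child c≼p e) c≼y)
  ... | ws , (walk , unique) , len , on-ws =
    x ∷ ws , (step (inj₂ e) walk , ¬Any⇒All¬ ws x∉ws ∷ unique) , len′ , on-ws′
    where
    x∉ws : x ∉ ws
    x∉ws x∈ws with on-ws x∈ws
    ... | inj₁ x≼p = child⋠parent e x≼p
    ... | inj₂ x≼y with child-toward (≼-child a≼p e) (λ { refl → child⋠parent e a≼p })
    ...   | c , ac , c≼x = no-common ac c≼x (≼-trans c≼x x≼y)
    len′ : suc (length ws) + (depth a + depth a) ≡ depth x + depth y + 1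
    len′ rewrite depth-child e = cong suc len
    on-ws′ : ∀ {z} → z ∈ x ∷ ws → z ≼ x ⊎ z ≼ y
    on-ws′ (here refl) = inj₁ ≼-refl
    on-ws′ (there z∈ws) = Sum.map₁ (λ z≼p → ≼-child z≼p e) (on-ws z∈ws)

  Covers : List (Fin n) → Fin n → Fin n → Set
  Covers vs a x = ∀ {z} → a ≼ z → z ≼ x → z ∈ vs

  record Apex (u v : Fin n) (vs : List (Fin n)) : Set where
    constructor mkApex
    field
      top        : Fin n
      top-lca    : IsLCA top u v
      top-length : length vs + (depth top + depth top) ≡ depth u + depth v + 1
      covers-u   : Covers vs top u
      covers-v   : Covers vs top v

  apex-here : ∀ {u} → Apex u u [ u ]
  apex-here {u} = mkApex u (≼-refl , ≼-refl , λ uc c≼u _ → child⋠parent uc c≼u)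
                           (+-comm 1 (depth u + depth u)) covers covers
    where
    covers : Covers [ u ] u u
    covers u≼z z≼u = here (sym (≼-antisym u≼z z≼u))

  -- A path that steps down from u to its child w must have its apex at w: otherwise u lies
  -- between the apex and w and would be visited twice.
  apex-down : ∀ {u w v vs} → (u , w) ∈ es → u ∉ vs → Apex w v vs → Apex u v (u ∷ vs)
  apex-down {u} {w} {v} {vs} uw u∉vs (mkApex m (m≼w , m≼v , _) len covers-w covers-v) with m ≟ w
  ... | no m≢w = ⊥-elim (u∉vs (covers-w (≼-parent m≼w m≢w uw) (≼-child ≼-refl uw)))
  ... | yes refl =
    mkApex u (≼-refl , ≼-trans (≼-child ≼-refl uw) m≼v , λ uc c≼u _ → child⋠parent uc c≼u)
             len′ covers-u′ covers-v′
    where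
    len′ : suc (length vs) + (depth u + depth u) ≡ depth u + depth v + 1
    len′ = suc-injective (trans (suc-suc-+-double (length vs) (depth u))
             (subst (λ t → length vs + (t + t) ≡ t + depth v + 1) (depth-child uw) len))
    covers-u′ : Covers (u ∷ vs) u u
    covers-u′ u≼z z≼u = here (sym (≼-antisym u≼z z≼u))
    covers-v′ : Covers (u ∷ vs) u v
    covers-v′ {z} u≼z z≼v with u ≟ z
    ... | yes refl = here refl
    ... | no u≢z = there (covers-v (≼-linear m≼v z≼v m≤z) z≼v)
      where
      m≤z : depth m ≤ depth z
      m≤z = subst (_≤ depth z) (sym (depth-child uw)) (≼∧≢⇒depth< u≼z u≢z)

  apex-up : ∀ {u w v vs} → (w , u) ∈ es → u ∉ vs → Apex w v vs → Apex u v (u ∷ vs)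
  apex-up {u} {_} {v} {vs} wu u∉vs (mkApex m (m≼w , m≼v , no-common) len covers-w covers-v) =
    mkApex m (≼-child m≼w wu , m≼v , no-common′) len′ covers-u′
             (λ m≼z z≼v → there (covers-v m≼z z≼v))
    where
    no-common′ : NoCommonChild m u v
    no-common′ {c} mc c≼u c≼v with c ≟ u
    ... | yes refl = u∉vs (covers-v (≼-child ≼-refl mc) c≼v)
    ... | no c≢u   = no-common mc (≼-parent c≼u c≢u wu) c≼v
    len′ : suc (length vs) + (depth m + depth m) ≡ depth u + depth v + 1
    len′ rewrite depth-child wu = cong suc len
    covers-u′ : Covers (u ∷ vs) m u
    covers-u′ {z} m≼z z≼u with z ≟ u
    ... | yes refl = here refl
    ... | no z≢u   = there (covers-w m≼z (≼-parent z≼u z≢u wu))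

  path-apex : ∀ {u v vs} → Walk (TreeAdj es) u v vs → Unique vs → Apex u v vs
  path-apex here                  _             = apex-here
  path-apex (step (inj₁ uw) walk) (u∉ ∷ unique) =
    apex-down uw (All¬⇒¬Any u∉) (path-apex walk unique)
  path-apex (step (inj₂ wu) walk) (u∉ ∷ unique) =
    apex-up wu (All¬⇒¬Any u∉) (path-apex walk unique)

  lca-path-longer : ∀ {u v w a} m (vs : List (Fin n)) →
                    length vs + (depth m + depth m) ≡ depth u + depth v + 1 →
                    IsLCA a u w → depth a ≤ depth m → depth v < depth w →
                    ∃[ ws ] (TreePath u w ws × length vs < length ws)
  lca-path-longer {u} {v} {w} {a} m vs len-vs (a≼u , a≼w , no-common) da≤dm dv<dw
    with via-lca a≼u a≼w no-common
  ... | ws , path , len-ws , _ =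
    ws , path , +-cancelʳ-< (depth m + depth m) (length vs) (length ws) longer
    where
    open ≤-Reasoning
    longer : length vs + (depth m + depth m) < length ws + (depth m + depth m)
    longer = begin-strict
      length vs + (depth m + depth m) ≡⟨ len-vs ⟩
      depth u + depth v + 1           <⟨ +-monoˡ-< 1 (+-monoʳ-< (depth u) dv<dw) ⟩
      depth u + depth w + 1           ≡⟨ sym len-ws ⟩
      length ws + (depth a + depth a) ≤⟨ +-monoʳ-≤ (length ws) (+-mono-≤ da≤dm da≤dm) ⟩
      length ws + (depth m + depth m) ∎

  lcas-not-both-below : ∀ {m u v w a b} → IsLCA m u v → IsLCA a u w → IsLCA b v w →
                        depth m < depth a → depth m < depth b → ⊥
  lcas-not-both-below (m≼u , m≼v , no-common) (a≼u , a≼w , _) (b≼v , b≼w , _) dm<da dm<db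
    with child-toward-deeper m≼u a≼u dm<da | child-toward-deeper m≼v b≼v dm<db
  ... | c , mc , c≼a | c′ , mc′ , c′≼b
    with ≼-depth-injective (≼-trans c≼a a≼w) (≼-trans c′≼b b≼w)
                           (trans (depth-child mc) (sym (depth-child mc′)))
  ... | refl = no-common mc (≼-trans c≼a a≼u) (≼-trans c′≼b b≼v)

  ¬deeper-than-both-ends : ∀ {u v w} → Diametral es u v → depth u < depth w → depth v < depth w → ⊥
  ¬deeper-than-both-ends {u} {v} {w} (vs , (walk , unique) , longest) du<dw dv<dw
    with path-apex walk unique | lca u w | lca v w
  ... | mkApex m m-lca len _ _ | a , a-lca | b , b-lca with depth a ≤? depth m | depth b ≤? depth m
  ... | yes da≤dm | _ with lca-path-longer m vs len a-lca da≤dm dv<dw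
  ...   | ws , path , longer = <⇒≱ longer (longest u w ws path)
  ¬deeper-than-both-ends {u} {v} {w} (vs , (walk , unique) , longest) du<dw dv<dw
    | mkApex m m-lca len _ _ | a , a-lca | b , b-lca | no _ | yes db≤dm
    with lca-path-longer m vs (trans len (cong (_+ 1) (+-comm (depth u) (depth v))))
                         b-lca db≤dm du<dw
  ...   | ws , path , longer = <⇒≱ longer (longest v w ws path)
  ¬deeper-than-both-ends {u} {v} {w} (vs , (walk , unique) , longest) du<dw dv<dw
    | mkApex m m-lca len _ _ | a , a-lca | b , b-lca | no da≰dm | no db≰dm =
    lcas-not-both-below m-lca a-lca b-lca (≰⇒> da≰dm) (≰⇒> db≰dm)

record BreadthFirstTree {n : ℕ} (G : Graph n) (es : List (Fin n × Fin n)) : Set where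
  field
    rooted         : RootedTree es
    edge-in-G      : ∀ {p x} → (p , x) ∈ es → GAdj G p x
    depth-adjacent : ∀ {x y} → GAdj G x y →
                     RootedTree.depth rooted y ≤ suc (RootedTree.depth rooted x)

module BreadthFirstSearch {n : ℕ} (G : Graph n) (r : Fin n) where

  Explored : (Fin n → ℕ) → List (Fin n) → Fin n → Set
  Explored d vis x = ∀ y → GAdj G x y → y ∈ vis × d y ≤ suc (d x)

  Sorted : (Fin n → ℕ) → List (Fin n) → Set
  Sorted d = AllPairs (λ x y → d x ≤ d y)

  Sorted-cong : ∀ {d d′ q} → (∀ {z} → z ∈ q → d z ≡ d′ z) → Sorted d q → Sorted d′ q
  Sorted-cong eq []            = []
  Sorted-cong eq (h≤ ∷ sorted) =
    All.tabulate (λ z∈ → subst₂ _≤_ (eq (here refl)) (eq (there z∈)) (All.lookup h≤ z∈)) ∷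
    Sorted-cong (eq ∘ there) sorted

  WithinLevel : (Fin n → ℕ) → List (Fin n) → List (Fin n) → Set
  WithinLevel d vis []      = ⊤
  WithinLevel d vis (h ∷ _) = ∀ {z} → z ∈ vis → d z ≤ suc (d h)

  record TreeInvariant (d : Fin n → ℕ) (vis : List (Fin n)) (es : List (Fin n × Fin n)) : Set where
    field
      root-visited  : r ∈ vis
      depth-root    : d r ≡ 0
      depth-child   : ∀ {p x} → (p , x) ∈ es → d x ≡ suc (d p)
      parent-unique : ∀ {p q x} → (p , x) ∈ es → (q , x) ∈ es → p ≡ q
      parent-exists : ∀ {x} → x ∈ vis → x ≢ r → ∃[ p ] ((p , x) ∈ es)
      edge-visited  : ∀ {p x} → (p , x) ∈ es → p ∈ vis × x ∈ vis
      edge-in-G     : ∀ {p x} → (p , x) ∈ es → GAdj G p x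

  record QueueInvariant (d : Fin n → ℕ) (q vis : List (Fin n)) : Set where
    field
      queue-visited      : ∀ {x} → x ∈ q → x ∈ vis
      queue-sorted       : Sorted d q
      within-level       : WithinLevel d vis q
      queued-or-explored : ∀ {x} → x ∈ vis → x ∈ q ⊎ Explored d vis x

  record Invariant (s : BFSState n) : Set where
    field
      depth : Fin n → ℕ
      tree  : TreeInvariant depth (BFSState.visited s) (BFSState.edges s)
      queue : QueueInvariant depth (BFSState.queue s) (BFSState.visited s)

  initial : Invariant ⟨ r ∷ [] , r ∷ [] , [] ⟩
  initial = record
    { depth = const 0
    ; tree  = record
      { root-visited  = here refl
      ; depth-root    = refl
      ; depth-child   = λ ()
      ; parent-unique = λ ()
      ; parent-exists = λ { (here refl) r≢r → ⊥-elim (r≢r refl) }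
      ; edge-visited  = λ ()
      ; edge-in-G     = λ ()
      }
    ; queue = record
      { queue-visited      = id
      ; queue-sorted       = [] ∷ []
      ; within-level       = λ _ → z≤n
      ; queued-or-explored = inj₁
      }
    }

  module Discover (d : Fin n → ℕ) {x y : Fin n} {vis : List (Fin n)}
                  (x∈vis : x ∈ vis) (y∉vis : y ∉ vis) where

    d′ : Fin n → ℕ
    d′ = updateAt d y (const (suc (d x)))

    d′-visited : ∀ {z} → z ∈ vis → d′ z ≡ d z
    d′-visited {z} z∈vis = updateAt-minimal z y d (λ { refl → y∉vis z∈vis })

    d′-new : d′ y ≡ suc (d′ x)
    d′-new = trans (updateAt-updates y d) (cong suc (sym (d′-visited x∈vis)))

    tree-discover : ∀ {es} → GAdj G x y → TreeInvariant d vis es →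
                    TreeInvariant d′ (y ∷ vis) ((x , y) ∷ es)
    tree-discover {es} xy I = record
      { root-visited  = there root-visited
      ; depth-root    = trans (d′-visited root-visited) depth-root
      ; depth-child   = λ { (here refl) → d′-new ; (there e) → depth-child′ e }
      ; parent-unique = parent-unique′
      ; parent-exists = λ { (here refl) _ → x , here refl
                          ; (there z∈vis) z≢r → Product.map₂ there (parent-exists z∈vis z≢r) }
      ; edge-visited  = λ { (here refl) → there x∈vis , here refl
                          ; (there e) → Product.map there there (edge-visited e) }
      ; edge-in-G     = λ { (here refl) → xy ; (there e) → edge-in-G e }
      }
      where
      open TreeInvariant I
      depth-child′ : ∀ {p z} → (p , z) ∈ es → d′ z ≡ suc (d′ p)
      depth-child′ e with edge-visited e
      ... | p∈vis , z∈vis =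
        trans (d′-visited z∈vis) (trans (depth-child e) (cong suc (sym (d′-visited p∈vis))))
      parent-unique′ : ∀ {p q z} → (p , z) ∈ (x , y) ∷ es → (q , z) ∈ (x , y) ∷ es → p ≡ q
      parent-unique′ (here refl) (here refl) = refl
      parent-unique′ (here refl) (there e)   = ⊥-elim (y∉vis (proj₂ (edge-visited e)))
      parent-unique′ (there e)   (here refl) = ⊥-elim (y∉vis (proj₂ (edge-visited e)))
      parent-unique′ (there e)   (there e′)  = parent-unique e e′

    queue-discover : ∀ {q} → QueueInvariant d (x ∷ q) vis →
                     QueueInvariant d′ (x ∷ q ++ [ y ]) (y ∷ vis)
    queue-discover {q} I = record
      { queue-visited      = queue-visited′
      ; queue-sorted       = AllPairsₚ.++⁺
                               (Sorted-cong (sym ∘ d′-visited ∘ queue-visited) queue-sorted)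
                               ([] ∷ [])
                               (All.tabulate (λ z∈ → below-new (queue-visited z∈) ∷ []))
      ; within-level       = λ { (here refl) → ≤-reflexive d′-new
                               ; (there z∈vis) → subst (d′ _ ≤_) d′-new (below-new z∈vis) }
      ; queued-or-explored = queued-or-explored′
      }
      where
      open QueueInvariant I
      below-new : ∀ {z} → z ∈ vis → d′ z ≤ d′ y
      below-new z∈vis =
        subst₂ _≤_ (sym (d′-visited z∈vis)) (sym (updateAt-updates y d)) (within-level z∈vis)
      queue-visited′ : ∀ {z} → z ∈ x ∷ q ++ [ y ] → z ∈ y ∷ vis
      queue-visited′ z∈ with ∈-++⁻ (x ∷ q) z∈
      ... | inj₁ z∈xq        = there (queue-visited z∈xq)
      ... | inj₂ (here refl) = here refl
      queued-or-explored′ : ∀ {z} → z ∈ y ∷ vis → z ∈ x ∷ q ++ [ y ] ⊎ Explored d′ (y ∷ vis) z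
      queued-or-explored′ (here refl) = inj₁ (∈-++⁺ʳ (x ∷ q) (here refl))
      queued-or-explored′ (there z∈vis) with queued-or-explored z∈vis
      ... | inj₁ z∈xq     = inj₁ (∈-++⁺ˡ z∈xq)
      ... | inj₂ explored = inj₂ λ z′ zz′ → let z′∈vis , le = explored z′ zz′ in
        there z′∈vis ,
        subst₂ (λ a b → a ≤ suc b) (sym (d′-visited z′∈vis)) (sym (d′-visited z∈vis)) le

  queue-finish : ∀ {d x q vis} → (∀ y → GAdj G x y → y ∈ vis) →
                 QueueInvariant d (x ∷ q) vis → QueueInvariant d q vis
  queue-finish {d} {x} {q} {vis} x-done I = record
    { queue-visited      = queue-visited ∘ there
    ; queue-sorted       = AllPairs.tail queue-sorted
    ; within-level       = within-level′ q (AllPairs.head queue-sorted)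
    ; queued-or-explored = queued-or-explored′
    }
    where
    open QueueInvariant I
    within-level′ : ∀ q′ → All (λ z → d x ≤ d z) q′ → WithinLevel d vis q′
    within-level′ []      _         = tt
    within-level′ (h ∷ _) (x≤h ∷ _) z∈vis = ≤-trans (within-level z∈vis) (s≤s x≤h)
    queued-or-explored′ : ∀ {z} → z ∈ vis → z ∈ q ⊎ Explored d vis z
    queued-or-explored′ z∈vis with queued-or-explored z∈vis
    ... | inj₁ (here refl)  = inj₂ λ y xy → x-done y xy , within-level (x-done y xy)
    ... | inj₁ (there z∈q) = inj₁ z∈q
    ... | inj₂ explored     = inj₂ explored

  step-preserves : ∀ {s s′} → BFSStep G s s′ → Invariant s → Invariant s′
  step-preserves (discover x q vis es y xy y∉vis) I =
    record { depth = d′ ; tree = tree-discover xy tree ; queue = queue-discover queue }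
    where
    open Invariant I
    open Discover depth (QueueInvariant.queue-visited queue (here refl)) y∉vis
  step-preserves (finish x q vis es x-done) I =
    record { depth = depth ; tree = tree ; queue = queue-finish x-done queue }
    where open Invariant I

  run-preserves : ∀ {s s′} → Star (BFSStep G) s s′ → Invariant s → Invariant s′
  run-preserves ε            I = I
  run-preserves (st ◅ steps) I = run-preserves steps (step-preserves st I)

bfs-tree : ∀ {n} {G : Graph n} {es} → Connected G → IsBFSTree G es → BreadthFirstTree G es
bfs-tree {G = G} {es} connected (r , vis , run) = record
  { rooted = record
    { root          = r
    ; depth         = depth
    ; depth-root    = depth-root
    ; depth-child   = depth-child
    ; parent-unique = parent-unique
    ; parent-exists = parent-exists ∘ visited
    }
  ; edge-in-G      = edge-in-G
  ; depth-adjacent = λ {x} {y} xy → proj₂ (explored (visited x) y xy)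
  }
  where
  open BreadthFirstSearch G r
  open Invariant (run-preserves run initial)
  open TreeInvariant tree
  open QueueInvariant queue
  explored : ∀ {x} → x ∈ vis → Explored depth vis x
  explored x∈vis with queued-or-explored x∈vis
  ... | inj₂ x-explored = x-explored
  reachable : ∀ {x y ws} → x ∈ vis → Walk (GAdj G) x y ws → y ∈ vis
  reachable x∈vis here              = x∈vis
  reachable x∈vis (step {w = z} xz walk) = reachable (proj₁ (explored x∈vis z xz)) walk
  visited : ∀ x → x ∈ vis
  visited x = reachable root-visited (proj₁ (proj₂ (connected r x)))

In-or-Out : ∀ {n} (S : Fin n → Bool) x → In S x ⊎ Out S x
In-or-Out S x with S x
... | true  = inj₁ tt
... | false = inj₂ tt

Out⇒¬In : ∀ {n} (S : Fin n → Bool) x → Out S x → ¬ In S x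
Out⇒¬In S x with S x
... | true  = λ ()
... | false = λ _ ()

¬In⇒Out : ∀ {n} (S : Fin n → Bool) x → ¬ In S x → Out S x
¬In⇒Out S x with S x
... | true  = λ ¬t → ¬t tt
... | false = λ _ → tt

T-not-not⁺ : ∀ {b} → T b → T (not (not b))
T-not-not⁺ {true} t = t

T-not-not⁻ : ∀ {b} → T (not (not b)) → T b
T-not-not⁻ {true} t = t

module _ {n : ℕ} {G : Graph n} where

  open OneJoin

  InJoin : OneJoin G → Fin n → Set
  InJoin J x = In (A₁ J) x ⊎ In (A₂ J) x

  crossing-edge : (J : OneJoin G) → ∀ {x y} → GAdj G x y → In (V₁ J) x → Out (V₁ J) y →
                  In (A₁ J) x × In (A₂ J) y
  crossing-edge J {x} {y} xy x∈V₁ y∉V₁ with In-or-Out (A₁ J) x | In-or-Out (A₂ J) y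
  ... | inj₁ x∈A₁ | inj₁ y∈A₂ = x∈A₁ , y∈A₂
  ... | inj₂ x∉A₁ | _         = ⊥-elim (subst T (sep₁ J x y x∈V₁ x∉A₁ y∉V₁) xy)
  ... | inj₁ _    | inj₂ y∉A₂ =
    ⊥-elim (subst T (sep₂ J y x y∉V₁ y∉A₂ x∈V₁) (subst T (Graph.sym G x y) xy))

  swap : OneJoin G → OneJoin G
  swap J = record
    { V₁      = not ∘ V₁ J
    ; A₁      = A₂ J
    ; A₂      = A₁ J
    ; A₁⊆V₁   = A₂⊆V₂ J
    ; A₂⊆V₂   = λ x x∈A₁ → T-not-not⁺ (A₁⊆V₁ J x x∈A₁)
    ; clique  = λ x y x∈J y∈J → clique J x y (Sum.swap x∈J) (Sum.swap y∈J)
    ; sep₁    = λ x y x∉V₁ x∉A₂ y∈V₁ → sep₂ J x y x∉V₁ x∉A₂ (T-not-not⁻ y∈V₁)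
    ; sep₂    = λ x y x∈V₁ x∉A₁ y∉V₁ → sep₁ J x y (T-not-not⁻ x∈V₁) x∉A₁ y∉V₁
    ; A₁≠∅    = A₂≠∅ J
    ; V₁∖A₁≠∅ = V₂∖A₂≠∅ J
    ; A₂≠∅    = A₁≠∅ J
    ; V₂∖A₂≠∅ = Product.map₂ (Product.map₁ T-not-not⁺) (V₁∖A₁≠∅ J)
    }

module _ {n : ℕ} {G : Graph n} {es : List (Fin n × Fin n)} (B : BreadthFirstTree G es) where

  open BreadthFirstTree B
  open RootedTree rooted
  open RootedTreeProperties rooted
  open OneJoin

  join-shallow-if-root-in-V₁ : (J : OneJoin G) → In (V₁ J) root →
                               ∃[ w ] (∀ {z} → InJoin J z → depth z < depth w)
  join-shallow-if-root-in-V₁ J r∈V₁ with V₂∖A₂≠∅ J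
  ... | w , w∉V₁ , w∉A₂ with exit-edge (λ x → T? (V₁ J x)) (root-≼ w) r∈V₁ (Out⇒¬In (V₁ J) w w∉V₁)
  ... | p , c , pc , p∈V₁ , c∉V₁ , c≼w
    with crossing-edge J (edge-in-G pc) p∈V₁ (¬In⇒Out (V₁ J) c c∉V₁)
  ... | p∈A₁ , c∈A₂ = w , λ z∈J → ≤-trans (s≤s (near-p z∈J)) p+2≤w
    where
    near-p : ∀ {z} → InJoin J z → depth z ≤ suc (depth p)
    near-p {z} z∈J with z ≟ p
    ... | yes refl = n≤1+n (depth z)
    ... | no z≢p   = depth-adjacent (clique J p z (inj₁ p∈A₁) z∈J (z≢p ∘ sym))
    p+2≤w : suc (suc (depth p)) ≤ depth w
    p+2≤w = subst (_< depth w) (depth-child pc)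
                  (≼∧≢⇒depth< c≼w (λ { refl → Out⇒¬In (A₂ J) c w∉A₂ c∈A₂ }))

  join-shallow : (J : OneJoin G) → ∃[ w ] (∀ {z} → InJoin J z → depth z < depth w)
  join-shallow J with In-or-Out (V₁ J) root
  ... | inj₁ r∈V₁ = join-shallow-if-root-in-V₁ J r∈V₁
  ... | inj₂ r∉V₁ with join-shallow-if-root-in-V₁ (swap J) r∉V₁
  ...   | w , below = w , below ∘ Sum.swap

  diametral-not-both-in-join : ∀ {u v} → Diametral es u v → (J : OneJoin G) →
                               ¬ (InJoin J u × InJoin J v)
  diametral-not-both-in-join diametral J (u∈J , v∈J) with join-shallow J
  ... | w , below = ¬deeper-than-both-ends diametral (below u∈J) (below v∈J)

lemma15 : {n : ℕ} (G : Graph n) → Connected G →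
          (es : List (Fin n × Fin n)) → IsBFSTree G es →
          (u v : Fin n) → Diametral es u v →
          (J : OneJoin G) →
          ¬ ((In (OneJoin.A₁ J) u ⊎ In (OneJoin.A₂ J) u) ×
             (In (OneJoin.A₁ J) v ⊎ In (OneJoin.A₂ J) v))
lemma15 G connected es bfs u v diametral =
  diametral-not-both-in-join (bfs-tree connected bfs) diametral
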